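{- Let $n$ be a positive integer and $p$ a prime number with $\sqrt{n+1} < p \le n+1$. Let $\sigma_n := \prod_{q \text{ prime}} q^{\lfloor n/(q-1) \rfloor}$. Then $\vartheta_p\!\left(\frac{\sigma_n}{n!}\right) \in \{0, 1\}$. Moreover, $\vartheta_p\!\left(\frac{\sigma_n}{n!}\right) = 1$ if and only if $p = \left\lfloor \frac{n}{k} + 1 \right\rfloor$ for some positive integer $k$ with $k < \sqrt{n+1} + 1$.
   Context: For a prime $p$, $\vartheta_p$ denotes the $p$-adic valuation (extended to nonzero rationals by $\vartheta_p(a/b) = \vartheta_p(a) - \vartheta_p(b)$). $\lfloor\cdot\rfloor$ is the floor function. -}

module Defs where

open import Data.Nat using (ℕ; zero; suc; _+_; _*_; _∸_; _^_; _/_)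
open import Data.Nat.Divisibility using (_∣?_)
open import Data.Nat.Primality using (prime?)
open import Data.List using (List; map; upTo)
open import Data.Nat.ListAction using (product)
open import Data.Integer using (ℤ; +_; _-_)
open import Relation.Nullary using (yes; no)

-- p-adic valuation of a natural number (fuel-bounded, fuel = m suffices).
-- Conventions for degenerate inputs (never used in the theorem):
-- value 0 when p < 2 or m = 0.
valAux : ℕ → ℕ → ℕ → ℕ
valAux zero     p           m       = 0
valAux (suc f)  zero        m       = 0
valAux (suc f)  (suc zero)  m       = 0
valAux (suc f)  (suc (suc k)) zero  = 0
valAux (suc f)  (suc (suc k)) (suc m) with suc (suc k) ∣? suc m
... | yes _ = suc (valAux f (suc (suc k)) (suc m / suc (suc k)))
... | no  _ = 0

val : ℕ → ℕ → ℕ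
val p m = valAux m p m

valQ : ℕ → ℕ → ℕ → ℤ
valQ p a b = + val p a - + val p b

sigmaFactor : ℕ → ℕ → ℕ
sigmaFactor n zero = 1
sigmaFactor n (suc zero) = 1
sigmaFactor n (suc (suc k)) with prime? (suc (suc k))
... | yes _ = suc (suc k) ^ (n / suc k)
... | no  _ = 1

-- σ_n = ∏_{q prime} q^⌊n/(q-1)⌋ ; primes q > n+1 contribute q^0 = 1,
-- so the product over q ∈ {0, …, n+1} is the full product.
sigma : ℕ → ℕ
sigma n = product (map (sigmaFactor n) (upTo (suc (suc n))))

-- Write p = d + 1. Among the factors of σ_n only q = p is divisible by p, so ϑ_p(σ_n) = ⌊n/d⌋,
-- and since n < p² only the multiples of p (not of p²) contribute to n!, so ϑ_p(n!) = ⌊n/p⌋.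
-- From n + 1 < p² one gets n < (⌊n/p⌋ + 2) d, hence ⌊n/p⌋ ≤ ⌊n/d⌋ ≤ ⌊n/p⌋ + 1. The difference is 1
-- exactly when some k satisfies ⌊n/p⌋ < k ≤ ⌊n/d⌋, i.e. d k ≤ n < p k, i.e. d = ⌊n/k⌋; the choice
-- k = ⌊n/d⌋ = ⌊n/p⌋ + 1 also meets (k - 1)² ≤ ⌊n/p⌋ p ≤ n.
module Submission where

open import Defs
open import Data.Nat using (ℕ; _!; _+_; _*_; _∸_; _≤_; _<_; _/_; >-nonZero)
open import Data.Nat.Primality using (Prime)
open import Data.Integer using (ℤ; +_)
open import Data.Product using (_×_; Σ-syntax; ∃-syntax)
open import Data.Sum using (_⊎_)
open import Function.Bundles using (_⇔_)
open import Relation.Binary.PropositionalEquality using (_≡_)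

open import Data.Nat
open import Data.Nat.Properties
open import Data.Nat.Divisibility
open import Data.Nat.DivMod
open import Data.Nat.Primality
open import Data.Nat.ListAction using (product)
open import Data.Nat.ListAction.Properties using (product-++)
open import Data.List using (map; upTo; _∷ʳ_; [_]; _++_)
open import Data.List.Properties using (map-++; applyUpTo-∷ʳ)
open import Data.Integer using (_-_)
open import Data.Integer.Properties using ([+m]-[+n]≡m⊖n; n⊖n≡0; ⊖-≥)
open import Data.Product using (_,_; proj₁; proj₂)
open import Data.Sum using (inj₁; inj₂; [_,_]′)
open import Function.Base using (_∘_; id)
open import Function.Bundles using (mk⇔)
open import Function.Construct.Composition using (_⇔-∘_)
open import Relation.Nullary using (¬_; yes; no; contradiction)
open import Relation.Binary.PropositionalEquality
  using (_≢_; refl; sym; trans; cong; cong₂; subst; subst₂; ≢-sym; module ≡-Reasoning)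

m<[1+m/n]*n : ∀ m n .{{_ : NonZero n}} → m < suc (m / n) * n
m<[1+m/n]*n m n = begin-strict
  m                 ≡⟨ m≡m%n+[m/n]*n m n ⟩
  m % n + m / n * n <⟨ +-monoˡ-< (m / n * n) (m%n<n m n) ⟩
  n + m / n * n     ∎
  where open ≤-Reasoning

m*n≤o⇒m≤o/n : ∀ m {n o} .{{_ : NonZero n}} → m * n ≤ o → m ≤ o / n
m*n≤o⇒m≤o/n m {n} {o} m*n≤o = begin
  m         ≡⟨ m*n/n≡m m n ⟨
  m * n / n ≤⟨ /-monoˡ-≤ n m*n≤o ⟩
  o / n     ∎
  where open ≤-Reasoning

/-unique : ∀ {m n q} .{{_ : NonZero n}} → q * n ≤ m → m < suc q * n → m / n ≡ q
/-unique {q = q} lower upper =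
  ≤-antisym (s≤s⁻¹ (m<n*o⇒m/o<n upper)) (m*n≤o⇒m≤o/n q lower)

/-suc-∣ : ∀ {m d} .{{_ : NonZero d}} → d ∣ suc m → suc m / d ≡ suc (m / d)
/-suc-∣ {m} {d} (divides (suc c) 1+m≡[1+c]d) = begin
  suc m / d     ≡⟨ /-congˡ 1+m≡[1+c]d ⟩
  suc c * d / d ≡⟨ m*n/n≡m (suc c) d ⟩
  suc c         ≡⟨ cong suc (/-unique cd≤m m<[1+c]d) ⟨
  suc (m / d)   ∎
  where
  open ≡-Reasoning
  cd≤m : c * d ≤ m
  cd≤m = s≤s⁻¹ (subst (c * d <_) (sym 1+m≡[1+c]d) (m<n+m (c * d) (>-nonZero⁻¹ d)))
  m<[1+c]d : m < suc c * d
  m<[1+c]d = subst (m <_) 1+m≡[1+c]d (n<1+n m)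

/-suc-∤ : ∀ {m d} .{{_ : NonZero d}} → ¬ d ∣ suc m → suc m / d ≡ m / d
/-suc-∤ {m} {d} d∤1+m = /-unique (≤-trans (m/n*n≤m m d) (n≤1+n m)) 1+m<[1+m/d]d
  where
  1+m<[1+m/d]d : suc m < suc (m / d) * d
  1+m<[1+m/d]d = ≤∧≢⇒< (m<[1+m/n]*n m d) (λ eq → d∤1+m (divides (suc (m / d)) eq))

infix 4 _^_∥_

record _^_∥_ (p e m : ℕ) : Set where
  constructor exactly
  field
    cofactor  : ℕ
    factorise : m ≡ p ^ e * cofactor
    p∤cofactor : ¬ p ∣ cofactor

∥-coprime : ∀ {p m} → ¬ p ∣ m → p ^ 0 ∥ m
∥-coprime {m = m} p∤m = exactly m (sym (*-identityˡ m)) p∤m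

prime⇒∤1 : ∀ {p} → Prime p → ¬ p ∣ 1
prime⇒∤1 p-prime p∣1 = ¬prime[1] (subst Prime (∣1⇒≡1 p∣1) p-prime)

∥-pow : ∀ {p} e → Prime p → p ^ e ∥ p ^ e
∥-pow {p} e p-prime = exactly 1 (sym (*-identityʳ (p ^ e))) (prime⇒∤1 p-prime)

∥-one : ∀ {p} → Prime p → p ^ 0 ∥ 1
∥-one = ∥-pow 0

∥-* : ∀ {p e f a b} → Prime p → p ^ e ∥ a → p ^ f ∥ b → p ^ (e + f) ∥ a * b
∥-* {p} {e} {f} {a} {b} p-prime (exactly u a≡pᵉu p∤u) (exactly v b≡pᶠv p∤v) =
  exactly (u * v) ab≡pᵉ⁺ᶠuv (λ p∣uv → [ p∤u , p∤v ]′ (euclidsLemma u v p-prime p∣uv))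
  where
  open ≡-Reasoning
  ab≡pᵉ⁺ᶠuv : a * b ≡ p ^ (e + f) * (u * v)
  ab≡pᵉ⁺ᶠuv = begin
    a * b                     ≡⟨ cong₂ _*_ a≡pᵉu b≡pᶠv ⟩
    (p ^ e * u) * (p ^ f * v) ≡⟨ [m*n]*[o*p]≡[m*o]*[n*p] (p ^ e) u (p ^ f) v ⟩
    (p ^ e * p ^ f) * (u * v) ≡⟨ cong (_* (u * v)) (^-distribˡ-+-* p e f) ⟨
    p ^ (e + f) * (u * v)     ∎

¬∥0 : ∀ {p e} .{{_ : NonZero p}} → ¬ p ^ e ∥ 0
¬∥0 {p} {e} (exactly u 0≡pᵉu p∤u) with m*n≡0⇒m≡0∨n≡0 (p ^ e) (sym 0≡pᵉu)
... | inj₁ pᵉ≡0 = ≢-nonZero⁻¹ p (m^n≡0⇒m≡0 p e pᵉ≡0)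
... | inj₂ refl = p∤u (p ∣0)

∥-/ : ∀ {p e m} .{{_ : NonZero p}} → p ^ suc e ∥ m → p ∣ m × p ^ e ∥ m / p
∥-/ {p} {e} {m} (exactly u m≡pᵉ⁺¹u p∤u) =
  divides (p ^ e * u) m≡pᵉu*p , exactly u (trans (/-congˡ m≡pᵉu*p) (m*n/n≡m (p ^ e * u) p)) p∤u
  where
  m≡pᵉu*p : m ≡ p ^ e * u * p
  m≡pᵉu*p = trans m≡pᵉ⁺¹u (trans (*-assoc p (p ^ e) u) (*-comm p (p ^ e * u)))

module _ {k : ℕ} where

  private
    p : ℕ
    p = suc (suc k)

  valAux-∤ : ∀ f m → ¬ p ∣ m → valAux f p m ≡ 0
  valAux-∤ zero    m       _   = refl
  valAux-∤ (suc f) zero    _   = refl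
  valAux-∤ (suc f) (suc m) p∤m with p ∣? suc m
  ... | yes p∣m = contradiction p∣m p∤m
  ... | no  _   = refl

  valAux-∣ : ∀ f m → p ∣ suc m → valAux (suc f) p (suc m) ≡ suc (valAux f p (suc m / p))
  valAux-∣ f m p∣m with p ∣? suc m
  ... | yes _   = refl
  ... | no  p∤m = contradiction p∣m p∤m

  valAux-∥ : ∀ {e} f m → p ^ e ∥ m → m ≤ f → valAux f p m ≡ e
  valAux-∥ {zero} f m (exactly u m≡1*u p∤u) _ =
    valAux-∤ f m (subst (λ x → ¬ p ∣ x) (sym (trans m≡1*u (*-identityˡ u))) p∤u)
  valAux-∥ {suc e} f       zero    pᵉ⁺¹∥0 _  = contradiction pᵉ⁺¹∥0 ¬∥0
  valAux-∥ {suc e} (suc f) (suc m) pᵉ⁺¹∥m 1+m≤1+f = begin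
    valAux (suc f) p (suc m)     ≡⟨ valAux-∣ f m p∣m ⟩
    suc (valAux f p (suc m / p)) ≡⟨ cong suc (valAux-∥ f (suc m / p) pᵉ∥m/p m/p≤f) ⟩
    suc e                        ∎
    where
    open ≡-Reasoning
    p∣m : p ∣ suc m
    p∣m = proj₁ (∥-/ pᵉ⁺¹∥m)
    pᵉ∥m/p : p ^ e ∥ suc m / p
    pᵉ∥m/p = proj₂ (∥-/ pᵉ⁺¹∥m)
    m/p≤f : suc m / p ≤ f
    m/p≤f = s≤s⁻¹ (<-≤-trans (m/n<m (suc m) p (s≤s (s≤s z≤n))) 1+m≤1+f)

  val-∥ : ∀ {e m} → p ^ e ∥ m → val p m ≡ e
  val-∥ {m = m} pᵉ∥m = valAux-∥ m m pᵉ∥m ≤-refl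

∣m^n⇒∣m : ∀ {p m} n → Prime p → p ∣ m ^ n → p ∣ m
∣m^n⇒∣m         zero    p-prime p∣1   = contradiction p∣1 (prime⇒∤1 p-prime)
∣m^n⇒∣m {m = m} (suc n) p-prime p∣mᵐ⁺¹ =
  [ (λ p∣m → p∣m) , ∣m^n⇒∣m n p-prime ]′ (euclidsLemma m (m ^ n) p-prime p∣mᵐ⁺¹)

sigmaFactor-prime : ∀ n {k} → Prime (suc (suc k)) →
  sigmaFactor n (suc (suc k)) ≡ suc (suc k) ^ (n / suc k)
sigmaFactor-prime n {k} q-prime with prime? (suc (suc k))
... | yes _       = refl
... | no  ¬prime = contradiction q-prime ¬prime

∤sigmaFactor : ∀ n {p} q → Prime p → q ≢ p → ¬ p ∣ sigmaFactor n q
∤sigmaFactor n zero          p-prime _   = prime⇒∤1 p-prime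
∤sigmaFactor n (suc zero)    p-prime _   = prime⇒∤1 p-prime
∤sigmaFactor n (suc (suc j)) p-prime q≢p p∣factor with prime? (suc (suc j))
... | no  _       = prime⇒∤1 p-prime p∣factor
... | yes q-prime with prime⇒irreducible q-prime (∣m^n⇒∣m (n / suc j) p-prime p∣factor)
...   | inj₁ p≡1 = ¬prime[1] (subst Prime p≡1 p-prime)
...   | inj₂ p≡q = q≢p (sym p≡q)

sigmaUpTo : ℕ → ℕ → ℕ
sigmaUpTo n m = product (map (sigmaFactor n) (upTo m))

sigmaUpTo-suc : ∀ n m → sigmaUpTo n (suc m) ≡ sigmaUpTo n m * sigmaFactor n m
sigmaUpTo-suc n m = begin
  product (map (sigmaFactor n) (upTo (suc m)))    ≡⟨ cong (product ∘ map (sigmaFactor n)) (applyUpTo-∷ʳ id m) ⟨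
  product (map (sigmaFactor n) (upTo m ∷ʳ m))     ≡⟨ cong product (map-++ (sigmaFactor n) (upTo m) [ m ]) ⟩
  product (map (sigmaFactor n) (upTo m) ++ [ sigmaFactor n m ])
                                                  ≡⟨ product-++ (map (sigmaFactor n) (upTo m)) [ sigmaFactor n m ] ⟩
  sigmaUpTo n m * (sigmaFactor n m * 1)           ≡⟨ cong (sigmaUpTo n m *_) (*-identityʳ (sigmaFactor n m)) ⟩
  sigmaUpTo n m * sigmaFactor n m                 ∎
  where open ≡-Reasoning

∥-sigmaUpTo-≤ : ∀ n {p} m → Prime p → m ≤ p → p ^ 0 ∥ sigmaUpTo n m
∥-sigmaUpTo-≤ n zero    p-prime _     = ∥-one p-prime
∥-sigmaUpTo-≤ n {p} (suc m) p-prime 1+m≤p =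
  subst (p ^ 0 ∥_) (sym (sigmaUpTo-suc n m))
    (∥-* p-prime (∥-sigmaUpTo-≤ n m p-prime (<⇒≤ 1+m≤p))
                 (∥-coprime (∤sigmaFactor n m p-prime (<⇒≢ 1+m≤p))))

∥-sigmaUpTo-> : ∀ n {k} m → Prime (suc (suc k)) → suc (suc k) < m →
  suc (suc k) ^ (n / suc k) ∥ sigmaUpTo n m
∥-sigmaUpTo-> n {k} (suc m) p-prime p<1+m with m≤n⇒m<n∨m≡n (s≤s⁻¹ p<1+m)
... | inj₁ p<m =
  subst₂ (λ e → suc (suc k) ^ e ∥_) (+-identityʳ (n / suc k)) (sym (sigmaUpTo-suc n m))
      (∥-* p-prime (∥-sigmaUpTo-> n m p-prime p<m)
                   (∥-coprime (∤sigmaFactor n m p-prime (≢-sym (<⇒≢ p<m)))))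
... | inj₂ refl =
  subst (suc (suc k) ^ (n / suc k) ∥_) (sym (sigmaUpTo-suc n m))
      (∥-* p-prime (∥-sigmaUpTo-≤ n m p-prime ≤-refl)
                   (subst (suc (suc k) ^ (n / suc k) ∥_) (sym (sigmaFactor-prime n p-prime))
                     (∥-pow (n / suc k) p-prime)))

∥-sigma : ∀ n {k} → Prime (suc (suc k)) → suc (suc k) ≤ n + 1 →
  suc (suc k) ^ (n / suc k) ∥ sigma n
∥-sigma n {k} p-prime p≤n+1 =
  ∥-sigmaUpTo-> n (suc (suc n)) p-prime (s≤s (subst (suc (suc k) ≤_) (+-comm n 1) p≤n+1))

∥-factorial : ∀ {p} .{{_ : NonZero p}} m → Prime p → m < p * p → p ^ (m / p) ∥ m !
∥-factorial {p} zero p-prime _ = subst (λ e → p ^ e ∥ 1) (sym (0/n≡0 p)) (∥-one p-prime)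
∥-factorial {p} (suc m) p-prime 1+m<p² with p ∣? suc m
... | no p∤1+m = subst (λ e → p ^ e ∥ suc m !) (sym (/-suc-∤ p∤1+m))
      (∥-* p-prime (∥-coprime p∤1+m) (∥-factorial m p-prime (<-trans (n<1+n m) 1+m<p²)))
... | yes p∣1+m@(divides c 1+m≡cp) = subst (λ e → p ^ e ∥ suc m !) (sym (/-suc-∣ p∣1+m))
      (∥-* p-prime p¹∥1+m (∥-factorial m p-prime (<-trans (n<1+n m) 1+m<p²)))
  where
  c<p : c < p
  c<p = *-cancelʳ-< p c p (subst (_< p * p) 1+m≡cp 1+m<p²)
  p¹∥1+m : p ^ 1 ∥ suc m
  p¹∥1+m = exactly c (trans 1+m≡cp (trans (*-comm c p) (cong (_* c) (sym (*-identityʳ p)))))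
    (>⇒∤ {{c≢0}} c<p)
    where
    c≢0 : NonZero c
    c≢0 = ≢-nonZero (λ { refl → 1+n≢0 1+m≡cp })

QuotientSucc : ℕ → ℕ → Set
QuotientSucc n p = ∃[ k ] Σ[ k≥1 ∈ 1 ≤ k ]
  ((k ∸ 1) * (k ∸ 1) < n + 1 × p ≡ (_/_ n k {{>-nonZero k≥1}}) + 1)

module _ (n : ℕ) {d : ℕ} .{{_ : NonZero d}} (n+1<[1+d]² : n + 1 < suc d * suc d) where

  n/[1+d]<1+d : n / suc d < suc d
  n/[1+d]<1+d = m<n*o⇒m/o<n (<-trans (m<m+n n z<s) n+1<[1+d]²)

  n<[2+n/[1+d]]*d : n < suc (suc (n / suc d)) * d
  n<[2+n/[1+d]]*d with m≤n⇒m<n∨m≡n (s≤s⁻¹ n/[1+d]<1+d)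
  ... | inj₁ n/[1+d]<d = begin-strict
    n                                  <⟨ m<[1+m/n]*n n (suc d) ⟩
    suc (n / suc d) * suc d            ≡⟨ *-suc (suc (n / suc d)) d ⟩
    suc (n / suc d) + suc (n / suc d) * d ≤⟨ +-monoˡ-≤ (suc (n / suc d) * d) n/[1+d]<d ⟩
    d + suc (n / suc d) * d            ∎
    where open ≤-Reasoning
  ... | inj₂ n/[1+d]≡d = subst (λ b → n < suc (suc b) * d) (sym n/[1+d]≡d)
      (s<s⁻¹ (subst₂ _<_ (+-comm n 1) [1+d]²≡1+[2+d]d n+1<[1+d]²))
    where
    [1+d]²≡1+[2+d]d : suc d * suc d ≡ suc (suc (suc d) * d)
    [1+d]²≡1+[2+d]d = cong (λ x → suc (d + x)) (*-suc d d)

  n/d≡n/[1+d]∨n/d≡1+n/[1+d] : n / d ≡ n / suc d ⊎ n / d ≡ suc (n / suc d)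
  n/d≡n/[1+d]∨n/d≡1+n/[1+d] with m≤n⇒m<n∨m≡n (s≤s⁻¹ (m<n*o⇒m/o<n n<[2+n/[1+d]]*d))
  ... | inj₁ n/d<1+n/[1+d] = inj₁ (≤-antisym (s≤s⁻¹ n/d<1+n/[1+d]) (/-monoʳ-≤ n (n≤1+n d)))
  ... | inj₂ n/d≡1+n/[1+d] = inj₂ n/d≡1+n/[1+d]

  n/d≡1+n/[1+d]⇔QuotientSucc : n / d ≡ suc (n / suc d) ⇔ QuotientSucc n (suc d)
  n/d≡1+n/[1+d]⇔QuotientSucc = mk⇔ witness fromWitness
    where
    witness : n / d ≡ suc (n / suc d) → QuotientSucc n (suc d)
    witness n/d≡1+B = suc B , s≤s z≤n , B²<n+1 , 1+d≡n/[1+B]+1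
      where
      open ≤-Reasoning
      B : ℕ
      B = n / suc d
      B²<n+1 : B * B < n + 1
      B²<n+1 = begin-strict
        B * B     ≤⟨ *-monoʳ-≤ B (<⇒≤ n/[1+d]<1+d) ⟩
        B * suc d ≤⟨ m/n*n≤m n (suc d) ⟩
        n         <⟨ m<m+n n z<s ⟩
        n + 1     ∎
      d[1+B]≤n : d * suc B ≤ n
      d[1+B]≤n = subst (_≤ n) (trans (cong (_* d) n/d≡1+B) (*-comm (suc B) d)) (m/n*n≤m n d)
      n<[1+d][1+B] : n < suc d * suc B
      n<[1+d][1+B] = subst (n <_) (*-comm (suc B) (suc d)) (m<[1+m/n]*n n (suc d))
      1+d≡n/[1+B]+1 : suc d ≡ n / suc B + 1
      1+d≡n/[1+B]+1 = trans (+-comm 1 d) (cong (_+ 1) (sym (/-unique d[1+B]≤n n<[1+d][1+B])))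
    fromWitness : QuotientSucc n (suc d) → n / d ≡ suc (n / suc d)
    fromWitness (k , k≥1 , _ , 1+d≡n/k+1) with n/d≡n/[1+d]∨n/d≡1+n/[1+d]
    ... | inj₂ n/d≡1+n/[1+d] = n/d≡1+n/[1+d]
    ... | inj₁ n/d≡n/[1+d] =
      contradiction (<-≤-trans n/[1+d]<k (subst (k ≤_) n/d≡n/[1+d] k≤n/d)) (<-irrefl refl)
      where
      instance _ = >-nonZero k≥1
      d≡n/k : d ≡ n / k
      d≡n/k = suc-injective (trans 1+d≡n/k+1 (+-comm (n / k) 1))
      k≤n/d : k ≤ n / d
      k≤n/d = m*n≤o⇒m≤o/n k (subst (_≤ n) (trans (cong (_* k) (sym d≡n/k)) (*-comm d k)) (m/n*n≤m n k))
      n/[1+d]<k : n / suc d < k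
      n/[1+d]<k = m<n*o⇒m/o<n
        (subst (n <_) (trans (cong (λ q → suc q * k) (sym d≡n/k)) (*-comm (suc d) k)) (m<[1+m/n]*n n k))

[+n]-[+n]≡0 : ∀ n → + n - + n ≡ + 0
[+n]-[+n]≡0 n = trans ([+m]-[+n]≡m⊖n n n) (n⊖n≡0 n)

[+1+n]-[+n]≡1 : ∀ n → + suc n - + n ≡ + 1
[+1+n]-[+n]≡1 n = trans ([+m]-[+n]≡m⊖n (suc n) n) (trans (⊖-≥ (n≤1+n n)) (cong +_ (m+n∸n≡m 1 n)))

[+m]-[+n]≡0∨1 : ∀ {m n} → m ≡ n ⊎ m ≡ suc n → + m - + n ≡ + 0 ⊎ + m - + n ≡ + 1
[+m]-[+n]≡0∨1 {m} (inj₁ refl) = inj₁ ([+n]-[+n]≡0 m)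
[+m]-[+n]≡0∨1 {n = n} (inj₂ refl) = inj₂ ([+1+n]-[+n]≡1 n)

[+m]-[+n]≡1⇔m≡1+n : ∀ {m n} → m ≡ n ⊎ m ≡ suc n → (+ m - + n ≡ + 1 ⇔ m ≡ suc n)
[+m]-[+n]≡1⇔m≡1+n {m} (inj₁ refl) =
  mk⇔ (λ 0≡1 → contradiction (trans (sym ([+n]-[+n]≡0 m)) 0≡1) λ ())
      (λ n≡1+n → contradiction (sym n≡1+n) 1+n≢n)
[+m]-[+n]≡1⇔m≡1+n {n = n} (inj₂ refl) = mk⇔ (λ _ → refl) (λ _ → [+1+n]-[+n]≡1 n)

theorem2 : (n p : ℕ) → 1 ≤ n → Prime p → n + 1 < p * p → p ≤ n + 1 →
    (valQ p (sigma n) (n !) ≡ + 0 ⊎ valQ p (sigma n) (n !) ≡ + 1)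
    × (valQ p (sigma n) (n !) ≡ + 1
       ⇔ (∃[ k ] Σ[ k≥1 ∈ 1 ≤ k ]
            ((k ∸ 1) * (k ∸ 1) < n + 1
             × p ≡ (_/_ n k {{>-nonZero k≥1}}) + 1)))
theorem2 n zero          _ p-prime _ _ = contradiction p-prime ¬prime[0]
theorem2 n (suc zero)    _ p-prime _ _ = contradiction p-prime ¬prime[1]
theorem2 n p@(suc (suc k)) _ p-prime n+1<p² p≤n+1 =
  subst (λ v → (v ≡ + 0 ⊎ v ≡ + 1) × (v ≡ + 1 ⇔ QuotientSucc n p)) (sym valQ≡[+n/[p-1]]-[+n/p])
    ([+m]-[+n]≡0∨1 gap , n/d≡1+n/[1+d]⇔QuotientSucc n n+1<p² ⇔-∘ [+m]-[+n]≡1⇔m≡1+n gap)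
  where
  gap : n / suc k ≡ n / p ⊎ n / suc k ≡ suc (n / p)
  gap = n/d≡n/[1+d]∨n/d≡1+n/[1+d] n n+1<p²
  valQ≡[+n/[p-1]]-[+n/p] : valQ p (sigma n) (n !) ≡ + (n / suc k) - + (n / p)
  valQ≡[+n/[p-1]]-[+n/p] = cong₂ (λ a b → + a - + b)
    (val-∥ (∥-sigma n p-prime p≤n+1))
    (val-∥ (∥-factorial n p-prime (<-trans (m<m+n n z<s) n+1<p²)))
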